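{- Let $\Gamma$ be a set of patterns and $\varphi,\psi,\chi,\theta$ patterns such that $\varphi$ is a subpattern of $\chi$ and $\theta$ is obtained from $\chi$ by replacing one or more occurrences of $\varphi$ with $\psi$. If $\Gamma\vdash_{\mathcal{MG}^c}\varphi\leftrightarrow\psi$, then $\Gamma\vdash_{\mathcal{MG}^c}\chi\leftrightarrow\theta$.
   Context: Fix a countably infinite set $EVar$ of element variables and a set $\Sigma$ of constant symbols containing a distinguished "definedness symbol" $\lceil\,\rceil$. Patterns: $\varphi::= x\mid \sigma\mid \bot\mid \neg\varphi\mid \varphi\to\varphi\mid \varphi\wedge\varphi\mid\varphi\vee\varphi\mid \varphi\cdot\varphi\mid \forall x\varphi\mid\exists x\varphi$ ($\varphi\cdot\psi$ is application). Abbreviations: $\varphi\leftrightarrow\psi:=(\varphi\to\psi)\wedge(\psi\to\varphi)$, $\lceil\varphi\rceil:=\lceil\,\rceil\cdot\varphi$, $\lfloor\varphi\rfloor:=\neg\lceil\neg\varphi\rceil$, $\varphi=\psi:=\lfloor\varphi\leftrightarrow\psi\rfloor$. Replacement of occurrences is literal (no renaming of bound variables). $\Gamma\vdash\psi$ means there is a finite sequence ending in $\psi$ of axiom instances, elements of $\Gamma$, or consequences of earlier members by rules. Proof system $\mathcal{MG}^c$. Axioms: $\varphi\vee\varphi\to\varphi$; $\varphi\to\varphi\wedge\varphi$; $\varphi\to\varphi\vee\psi$; $\varphi\wedge\psi\to\varphi$; $\varphi\vee\psi\to\psi\vee\varphi$; $\varphi\wedge\psi\to\psi\wedge\varphi$;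 $\bot\to\varphi$; $\varphi\vee\neg\varphi$; $\neg\varphi\to(\varphi\to\bot)$; $(\varphi\to\bot)\to\neg\varphi$; $\forall x(\varphi\to\psi)\to(\forall x\varphi\to\forall x\psi)$; $\varphi\to\forall x\varphi$ if $x$ does not occur in $\varphi$; $\exists x(x=y)$ for $y$ distinct from $x$; $\exists x\varphi\to\neg\forall x\neg\varphi$; $\neg\forall x\neg\varphi\to\exists x\varphi$; $(\varphi\vee\psi)\cdot\chi\to\varphi\cdot\chi\vee\psi\cdot\chi$; $\chi\cdot(\varphi\vee\psi)\to\chi\cdot\varphi\vee\chi\cdot\psi$; $(\exists x\varphi)\cdot\psi\to\exists x(\varphi\cdot\psi)$ and $\psi\cdot(\exists x\varphi)\to\exists x(\psi\cdot\varphi)$ if $x$ does not occur in $\psi$; $\lceil\varphi\rceil\cdot\psi\to\lceil\varphi\rceil$; $\psi\cdot\lceil\varphi\rceil\to\lceil\varphi\rceil$; $\lceil x\rceil$; $\varphi\to\lceil\varphi\rceil$; $\lceil\bot\rceil\to\bot$. Rules: from $\varphi$, $\varphi\to\psi$ infer $\psi$; from $\varphi\to\psi$, $\psi\to\chi$ infer $\varphi\to\chi$; from $\varphi\wedge\psi\to\chi$ infer $\varphi\to(\psi\to\chi)$; from $\varphi\to(\psi\to\chi)$ infer $\varphi\wedge\psi\to\chi$; from $\varphi\to\psi$ infer $\chi\vee\varphi\to\chi\vee\psi$; from $\varphi$ infer $\forall x\varphi$; from $\varphi\to\psi$ infer $\varphi\cdot\chi\to\psi\cdot\chi$ and $\chi\cdot\varphi\to\chi\cdot\psi$.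 -}

module Defs where

open import Data.Nat using (ℕ; zero; suc; _+_)
open import Relation.Binary.PropositionalEquality using (_≡_; _≢_)
import Data.Empty

EVar : Set
EVar = ℕ

data Pattern (Σ : Set) : Set where
  var   : EVar → Pattern Σ
  sym   : Σ → Pattern Σ
  ⊥ₚ    : Pattern Σ
  ¬ₚ_   : Pattern Σ → Pattern Σ
  _⇒_   : Pattern Σ → Pattern Σ → Pattern Σ
  _∧ₚ_  : Pattern Σ → Pattern Σ → Pattern Σ
  _∨ₚ_  : Pattern Σ → Pattern Σ → Pattern Σ
  _·_   : Pattern Σ → Pattern Σ → Pattern Σ
  ∀ₚ    : EVar → Pattern Σ → Pattern Σ
  ∃ₚ    : EVar → Pattern Σ → Pattern Σ

infixr 5 _⇒_
infixr 6 _∨ₚ_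
infixr 7 _∧ₚ_
infixl 9 _·_
infix 8 ¬ₚ_

module _ {Σ : Set} where

  _⇔_ : Pattern Σ → Pattern Σ → Pattern Σ
  φ ⇔ ψ = (φ ⇒ ψ) ∧ₚ (ψ ⇒ φ)

  -- "x occurs in φ" (any occurrence, free, bound, or as a binder).
  data Occurs (x : EVar) : Pattern Σ → Set where
    o-var  : Occurs x (var x)
    o-¬    : ∀ {φ} → Occurs x φ → Occurs x (¬ₚ φ)
    o-⇒ˡ   : ∀ {φ ψ} → Occurs x φ → Occurs x (φ ⇒ ψ)
    o-⇒ʳ   : ∀ {φ ψ} → Occurs x ψ → Occurs x (φ ⇒ ψ)
    o-∧ˡ   : ∀ {φ ψ} → Occurs x φ → Occurs x (φ ∧ₚ ψ)
    o-∧ʳ   : ∀ {φ ψ} → Occurs x ψ → Occurs x (φ ∧ₚ ψ)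
    o-∨ˡ   : ∀ {φ ψ} → Occurs x φ → Occurs x (φ ∨ₚ ψ)
    o-∨ʳ   : ∀ {φ ψ} → Occurs x ψ → Occurs x (φ ∨ₚ ψ)
    o-·ˡ   : ∀ {φ ψ} → Occurs x φ → Occurs x (φ · ψ)
    o-·ʳ   : ∀ {φ ψ} → Occurs x ψ → Occurs x (φ · ψ)
    o-∀b   : ∀ {φ} → Occurs x (∀ₚ x φ)
    o-∀    : ∀ {y φ} → Occurs x φ → Occurs x (∀ₚ y φ)
    o-∃b   : ∀ {φ} → Occurs x (∃ₚ x φ)
    o-∃    : ∀ {y φ} → Occurs x φ → Occurs x (∃ₚ y φ)

  data Subpattern (φ : Pattern Σ) : Pattern Σ → Set where
    sp-refl : Subpattern φ φ
    sp-¬    : ∀ {χ} → Subpattern φ χ → Subpattern φ (¬ₚ χ)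
    sp-⇒ˡ   : ∀ {χ₁ χ₂} → Subpattern φ χ₁ → Subpattern φ (χ₁ ⇒ χ₂)
    sp-⇒ʳ   : ∀ {χ₁ χ₂} → Subpattern φ χ₂ → Subpattern φ (χ₁ ⇒ χ₂)
    sp-∧ˡ   : ∀ {χ₁ χ₂} → Subpattern φ χ₁ → Subpattern φ (χ₁ ∧ₚ χ₂)
    sp-∧ʳ   : ∀ {χ₁ χ₂} → Subpattern φ χ₂ → Subpattern φ (χ₁ ∧ₚ χ₂)
    sp-∨ˡ   : ∀ {χ₁ χ₂} → Subpattern φ χ₁ → Subpattern φ (χ₁ ∨ₚ χ₂)
    sp-∨ʳ   : ∀ {χ₁ χ₂} → Subpattern φ χ₂ → Subpattern φ (χ₁ ∨ₚ χ₂)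
    sp-·ˡ   : ∀ {χ₁ χ₂} → Subpattern φ χ₁ → Subpattern φ (χ₁ · χ₂)
    sp-·ʳ   : ∀ {χ₁ χ₂} → Subpattern φ χ₂ → Subpattern φ (χ₁ · χ₂)
    sp-∀    : ∀ {x χ} → Subpattern φ χ → Subpattern φ (∀ₚ x χ)
    sp-∃    : ∀ {x χ} → Subpattern φ χ → Subpattern φ (∃ₚ x χ)

  -- Replace φ χ θ n : θ is obtained from χ by literally replacing exactly n
  -- (chosen) occurrences of φ by ψ (no renaming of bound variables).
  data Replace (φ ψ : Pattern Σ) : Pattern Σ → Pattern Σ → ℕ → Set where
    r-here : Replace φ ψ φ ψ 1
    r-var  : ∀ {x} → Replace φ ψ (var x) (var x) 0
    r-sym  : ∀ {s} → Replace φ ψ (sym s) (sym s) 0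
    r-⊥    : Replace φ ψ ⊥ₚ ⊥ₚ 0
    r-¬    : ∀ {χ θ n} → Replace φ ψ χ θ n → Replace φ ψ (¬ₚ χ) (¬ₚ θ) n
    r-⇒    : ∀ {χ₁ θ₁ n₁ χ₂ θ₂ n₂} → Replace φ ψ χ₁ θ₁ n₁ → Replace φ ψ χ₂ θ₂ n₂
           → Replace φ ψ (χ₁ ⇒ χ₂) (θ₁ ⇒ θ₂) (n₁ + n₂)
    r-∧    : ∀ {χ₁ θ₁ n₁ χ₂ θ₂ n₂} → Replace φ ψ χ₁ θ₁ n₁ → Replace φ ψ χ₂ θ₂ n₂
           → Replace φ ψ (χ₁ ∧ₚ χ₂) (θ₁ ∧ₚ θ₂) (n₁ + n₂)
    r-∨    : ∀ {χ₁ θ₁ n₁ χ₂ θ₂ n₂} → Replace φ ψ χ₁ θ₁ n₁ → Replace φ ψ χ₂ θ₂ n₂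
           → Replace φ ψ (χ₁ ∨ₚ χ₂) (θ₁ ∨ₚ θ₂) (n₁ + n₂)
    r-·    : ∀ {χ₁ θ₁ n₁ χ₂ θ₂ n₂} → Replace φ ψ χ₁ θ₁ n₁ → Replace φ ψ χ₂ θ₂ n₂
           → Replace φ ψ (χ₁ · χ₂) (θ₁ · θ₂) (n₁ + n₂)
    r-∀    : ∀ {x χ θ n} → Replace φ ψ χ θ n → Replace φ ψ (∀ₚ x χ) (∀ₚ x θ) n
    r-∃    : ∀ {x χ θ n} → Replace φ ψ χ θ n → Replace φ ψ (∃ₚ x χ) (∃ₚ x θ) n

-- The proof system MG^c, relative to a distinguished definedness symbol d.
module MG {Σ : Set} (d : Σ) where

  ⌈_⌉ : Pattern Σ → Pattern Σ
  ⌈ φ ⌉ = sym d · φ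

  ⌊_⌋ : Pattern Σ → Pattern Σ
  ⌊ φ ⌋ = ¬ₚ ⌈ ¬ₚ φ ⌉

  _≐_ : Pattern Σ → Pattern Σ → Pattern Σ
  φ ≐ ψ = ⌊ φ ⇔ ψ ⌋

  data _⊢_ (Γ : Pattern Σ → Set) : Pattern Σ → Set where
    hyp     : ∀ {φ} → Γ φ → Γ ⊢ φ
    ax-∨idem  : ∀ {φ} → Γ ⊢ (φ ∨ₚ φ ⇒ φ)
    ax-∧dup   : ∀ {φ} → Γ ⊢ (φ ⇒ φ ∧ₚ φ)
    ax-∨intro : ∀ {φ ψ} → Γ ⊢ (φ ⇒ φ ∨ₚ ψ)
    ax-∧elim  : ∀ {φ ψ} → Γ ⊢ (φ ∧ₚ ψ ⇒ φ)
    ax-∨comm  : ∀ {φ ψ} → Γ ⊢ (φ ∨ₚ ψ ⇒ ψ ∨ₚ φ)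
    ax-∧comm  : ∀ {φ ψ} → Γ ⊢ (φ ∧ₚ ψ ⇒ ψ ∧ₚ φ)
    ax-⊥      : ∀ {φ} → Γ ⊢ (⊥ₚ ⇒ φ)
    ax-lem    : ∀ {φ} → Γ ⊢ (φ ∨ₚ ¬ₚ φ)
    ax-¬elim  : ∀ {φ} → Γ ⊢ (¬ₚ φ ⇒ (φ ⇒ ⊥ₚ))
    ax-¬intro : ∀ {φ} → Γ ⊢ ((φ ⇒ ⊥ₚ) ⇒ ¬ₚ φ)
    ax-∀K     : ∀ {x φ ψ} → Γ ⊢ (∀ₚ x (φ ⇒ ψ) ⇒ (∀ₚ x φ ⇒ ∀ₚ x ψ))
    ax-∀vac   : ∀ {x φ} → (Occurs x φ → Data.Empty.⊥) → Γ ⊢ (φ ⇒ ∀ₚ x φ)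
    ax-exist  : ∀ {x y} → x ≢ y → Γ ⊢ ∃ₚ x (var x ≐ var y)
    ax-∃→     : ∀ {x φ} → Γ ⊢ (∃ₚ x φ ⇒ ¬ₚ ∀ₚ x (¬ₚ φ))
    ax-∃←     : ∀ {x φ} → Γ ⊢ (¬ₚ ∀ₚ x (¬ₚ φ) ⇒ ∃ₚ x φ)
    ax-prop∨ˡ : ∀ {φ ψ χ} → Γ ⊢ ((φ ∨ₚ ψ) · χ ⇒ φ · χ ∨ₚ ψ · χ)
    ax-prop∨ʳ : ∀ {φ ψ χ} → Γ ⊢ (χ · (φ ∨ₚ ψ) ⇒ χ · φ ∨ₚ χ · ψ)
    ax-prop∃ˡ : ∀ {x φ ψ} → (Occurs x ψ → Data.Empty.⊥)
              → Γ ⊢ ((∃ₚ x φ) · ψ ⇒ ∃ₚ x (φ · ψ))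
    ax-prop∃ʳ : ∀ {x φ ψ} → (Occurs x ψ → Data.Empty.⊥)
              → Γ ⊢ (ψ · (∃ₚ x φ) ⇒ ∃ₚ x (ψ · φ))
    ax-⌈⌉ˡ    : ∀ {φ ψ} → Γ ⊢ (⌈ φ ⌉ · ψ ⇒ ⌈ φ ⌉)
    ax-⌈⌉ʳ    : ∀ {φ ψ} → Γ ⊢ (ψ · ⌈ φ ⌉ ⇒ ⌈ φ ⌉)
    ax-defvar : ∀ {x} → Γ ⊢ ⌈ var x ⌉
    ax-def    : ∀ {φ} → Γ ⊢ (φ ⇒ ⌈ φ ⌉)
    ax-def⊥   : Γ ⊢ (⌈ ⊥ₚ ⌉ ⇒ ⊥ₚ)
    mp        : ∀ {φ ψ} → Γ ⊢ φ → Γ ⊢ (φ ⇒ ψ) → Γ ⊢ ψ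
    syl       : ∀ {φ ψ χ} → Γ ⊢ (φ ⇒ ψ) → Γ ⊢ (ψ ⇒ χ) → Γ ⊢ (φ ⇒ χ)
    exp       : ∀ {φ ψ χ} → Γ ⊢ (φ ∧ₚ ψ ⇒ χ) → Γ ⊢ (φ ⇒ (ψ ⇒ χ))
    imp       : ∀ {φ ψ χ} → Γ ⊢ (φ ⇒ (ψ ⇒ χ)) → Γ ⊢ (φ ∧ₚ ψ ⇒ χ)
    exp∨      : ∀ {φ ψ χ} → Γ ⊢ (φ ⇒ ψ) → Γ ⊢ (χ ∨ₚ φ ⇒ χ ∨ₚ ψ)
    gen       : ∀ {x φ} → Γ ⊢ φ → Γ ⊢ ∀ₚ x φ
    framingˡ  : ∀ {φ ψ χ} → Γ ⊢ (φ ⇒ ψ) → Γ ⊢ (φ · χ ⇒ ψ · χ)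
    framingʳ  : ∀ {φ ψ χ} → Γ ⊢ (φ ⇒ ψ) → Γ ⊢ (χ · φ ⇒ χ · ψ)

module Submission where

open import Defs
open import Data.Nat using (ℕ; _≤_)
open import Data.Product using (_×_; _,_)

module Derivable {Σ : Set} (d : Σ) (Γ : Pattern Σ → Set) where
  open MG d

  ⇒-refl : ∀ {A} → Γ ⊢ (A ⇒ A)
  ⇒-refl = syl ax-∧dup ax-∧elim

  ∧-intro : ∀ {A B} → Γ ⊢ A → Γ ⊢ B → Γ ⊢ (A ∧ₚ B)
  ∧-intro a b = mp b (mp a (exp ⇒-refl))

  ∧-elimˡ : ∀ {A B} → Γ ⊢ (A ∧ₚ B) → Γ ⊢ A
  ∧-elimˡ p = mp p ax-∧elim

  ∧-elimʳ : ∀ {A B} → Γ ⊢ (A ∧ₚ B) → Γ ⊢ B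
  ∧-elimʳ p = ∧-elimˡ (mp p ax-∧comm)

  ⇒-eval : ∀ {A B} → Γ ⊢ ((A ⇒ B) ∧ₚ A ⇒ B)
  ⇒-eval = imp ⇒-refl

  ∧-monoˡ : ∀ {A A' B} → Γ ⊢ (A ⇒ A') → Γ ⊢ (A ∧ₚ B ⇒ A' ∧ₚ B)
  ∧-monoˡ h = imp (syl h (exp ⇒-refl))

  ∧-monoʳ : ∀ {A B B'} → Γ ⊢ (B ⇒ B') → Γ ⊢ (A ∧ₚ B ⇒ A ∧ₚ B')
  ∧-monoʳ h = syl ax-∧comm (syl (∧-monoˡ h) ax-∧comm)

  ∧-mono : ∀ {A A' B B'} → Γ ⊢ (A ⇒ A') → Γ ⊢ (B ⇒ B') → Γ ⊢ (A ∧ₚ B ⇒ A' ∧ₚ B')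
  ∧-mono ha hb = syl (∧-monoˡ ha) (∧-monoʳ hb)

  ∨-mono : ∀ {A A' B B'} → Γ ⊢ (A ⇒ A') → Γ ⊢ (B ⇒ B') → Γ ⊢ (A ∨ₚ B ⇒ A' ∨ₚ B')
  ∨-mono ha hb = syl ax-∨comm (syl (exp∨ ha) (syl ax-∨comm (exp∨ hb)))

  ·-mono : ∀ {A A' B B'} → Γ ⊢ (A ⇒ A') → Γ ⊢ (B ⇒ B') → Γ ⊢ (A · B ⇒ A' · B')
  ·-mono ha hb = syl (framingˡ ha) (framingʳ hb)

  ⇒-mono : ∀ {A A' B B'} → Γ ⊢ (A' ⇒ A) → Γ ⊢ (B ⇒ B') → Γ ⊢ ((A ⇒ B) ⇒ (A' ⇒ B'))
  ⇒-mono ha hb = exp (syl (∧-monoʳ ha) (syl ⇒-eval hb))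

  -- From ¬ B ∧ A ⇒ ¬ B ∧ B ⇒ ⊥, curried and closed by ¬-introduction.
  ¬-antimono : ∀ {A B} → Γ ⊢ (A ⇒ B) → Γ ⊢ (¬ₚ B ⇒ ¬ₚ A)
  ¬-antimono h = syl (exp (syl (∧-monoʳ h) (imp ax-¬elim))) ax-¬intro

  ∀-mono : ∀ {x A B} → Γ ⊢ (A ⇒ B) → Γ ⊢ (∀ₚ x A ⇒ ∀ₚ x B)
  ∀-mono h = mp (gen h) ax-∀K

  -- ∃ x A is interderivable with ¬ ∀ x ¬ A, which is monotone in A.
  ∃-mono : ∀ {x A B} → Γ ⊢ (A ⇒ B) → Γ ⊢ (∃ₚ x A ⇒ ∃ₚ x B)
  ∃-mono h = syl ax-∃→ (syl (¬-antimono (∀-mono (¬-antimono h))) ax-∃←)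

  infix 4 _⊣⊢_

  _⊣⊢_ : Pattern Σ → Pattern Σ → Set
  A ⊣⊢ B = Γ ⊢ (A ⇒ B) × Γ ⊢ (B ⇒ A)

  ⇔⇒⊣⊢ : ∀ {A B} → Γ ⊢ (A ⇔ B) → A ⊣⊢ B
  ⇔⇒⊣⊢ h = ∧-elimˡ h , ∧-elimʳ h

  ⊣⊢⇒⇔ : ∀ {A B} → A ⊣⊢ B → Γ ⊢ (A ⇔ B)
  ⊣⊢⇒⇔ (ab , ba) = ∧-intro ab ba

  ⊣⊢-refl : ∀ {A} → A ⊣⊢ A
  ⊣⊢-refl = ⇒-refl , ⇒-refl

  ¬-cong : ∀ {A A'} → A ⊣⊢ A' → ¬ₚ A ⊣⊢ ¬ₚ A'
  ¬-cong (a , a') = ¬-antimono a' , ¬-antimono a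

  ⇒-cong : ∀ {A A' B B'} → A ⊣⊢ A' → B ⊣⊢ B' → (A ⇒ B) ⊣⊢ (A' ⇒ B')
  ⇒-cong (a , a') (b , b') = ⇒-mono a' b , ⇒-mono a b'

  ∧-cong : ∀ {A A' B B'} → A ⊣⊢ A' → B ⊣⊢ B' → A ∧ₚ B ⊣⊢ A' ∧ₚ B'
  ∧-cong (a , a') (b , b') = ∧-mono a b , ∧-mono a' b'

  ∨-cong : ∀ {A A' B B'} → A ⊣⊢ A' → B ⊣⊢ B' → A ∨ₚ B ⊣⊢ A' ∨ₚ B'
  ∨-cong (a , a') (b , b') = ∨-mono a b , ∨-mono a' b'

  ·-cong : ∀ {A A' B B'} → A ⊣⊢ A' → B ⊣⊢ B' → A · B ⊣⊢ A' · B'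
  ·-cong (a , a') (b , b') = ·-mono a b , ·-mono a' b'

  ∀-cong : ∀ {x A A'} → A ⊣⊢ A' → ∀ₚ x A ⊣⊢ ∀ₚ x A'
  ∀-cong (a , a') = ∀-mono a , ∀-mono a'

  ∃-cong : ∀ {x A A'} → A ⊣⊢ A' → ∃ₚ x A ⊣⊢ ∃ₚ x A'
  ∃-cong (a , a') = ∃-mono a , ∃-mono a'

  Replace-cong : ∀ {φ ψ χ θ n} → φ ⊣⊢ ψ → Replace φ ψ χ θ n → χ ⊣⊢ θ
  Replace-cong eq r-here    = eq
  Replace-cong eq r-var     = ⊣⊢-refl
  Replace-cong eq r-sym     = ⊣⊢-refl
  Replace-cong eq r-⊥       = ⊣⊢-refl
  Replace-cong eq (r-¬ r)   = ¬-cong (Replace-cong eq r)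
  Replace-cong eq (r-⇒ r s) = ⇒-cong (Replace-cong eq r) (Replace-cong eq s)
  Replace-cong eq (r-∧ r s) = ∧-cong (Replace-cong eq r) (Replace-cong eq s)
  Replace-cong eq (r-∨ r s) = ∨-cong (Replace-cong eq r) (Replace-cong eq s)
  Replace-cong eq (r-· r s) = ·-cong (Replace-cong eq r) (Replace-cong eq s)
  Replace-cong eq (r-∀ r)   = ∀-cong (Replace-cong eq r)
  Replace-cong eq (r-∃ r)   = ∃-cong (Replace-cong eq r)

mainTheorem11 : {Σ : Set} (d : Σ) (Γ : Pattern Σ → Set)
    (φ ψ χ θ : Pattern Σ) (n : ℕ)
    → Subpattern φ χ
    → Replace φ ψ χ θ n → 1 ≤ n
    → MG._⊢_ d Γ (φ ⇔ ψ)
    → MG._⊢_ d Γ (χ ⇔ θ)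
mainTheorem11 d Γ φ ψ χ θ n _ replace _ φ⇔ψ =
  ⊣⊢⇒⇔ (Replace-cong (⇔⇒⊣⊢ φ⇔ψ) replace)
  where open Derivable d Γ
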